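{- Every tree $T$ with maximum degree at most $3$ admits a red-blue vertex coloring such that every connected component of the subgraph induced by the blue vertices is a single vertex or a single edge, and every connected component of the subgraph induced by the red vertices is a star with $1$, $2$ or $3$ edges.
   Context: A red-blue vertex coloring assigns each vertex one of the colors red or blue; components of a color class are the connected components of the subgraph induced by the vertices of that color. A star with $m$ edges is $K_{1,m}$. -}

module Defs where

open import Data.Nat using (ℕ; zero; suc; _≤_; _+_)
open import Data.Bool using (Bool; true; false; if_then_else_)
open import Data.Fin using (Fin)
open import Data.List using (List; []; _∷_; allFin; map; length)
open import Data.Nat.ListAction using (sum)
open import Data.List.Relation.Unary.Unique.Propositional using (Unique)
open import Data.Product using (Σ; _×_; _,_; ∃)
open import Data.Sum using (_⊎_)
open import Relation.Binary.PropositionalEquality using (_≡_)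
open import Relation.Nullary using (¬_)
open import Function.Definitions using (Injective)

record Graph (n : ℕ) : Set where
  field
    edge    : Fin n → Fin n → Bool
    symm    : ∀ u v → edge u v ≡ edge v u
    irrefl  : ∀ v → edge v v ≡ false

module _ {n : ℕ} (G : Graph n) where
  open Graph G

  Adj : Fin n → Fin n → Set
  Adj u v = edge u v ≡ true

  degree : Fin n → ℕ
  degree v = sum (map (λ w → if edge v w then 1 else 0) (allFin n))

  MaxDegreeAtMost : ℕ → Set
  MaxDegreeAtMost k = ∀ v → degree v ≤ k

  data WalkIn (P : Fin n → Set) : Fin n → Fin n → Set where
    here : ∀ {u} → P u → WalkIn P u u
    step : ∀ {u w v} → P u → Adj u w → WalkIn P w v → WalkIn P u v

  Connected : Set
  Connected = ∀ u v → WalkIn (λ _ → Fin n) u v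

  data IsWalk : List (Fin n) → Set where
    nil  : IsWalk []
    one  : ∀ v → IsWalk (v ∷ [])
    cons : ∀ u v vs → Adj u v → IsWalk (v ∷ vs) → IsWalk (u ∷ v ∷ vs)

  data Last : List (Fin n) → Fin n → Set where
    lastOne  : ∀ v → Last (v ∷ []) v
    lastCons : ∀ u vs w → Last vs w → Last (u ∷ vs) w

  IsCycle : List (Fin n) → Set
  IsCycle vs = 3 ≤ length vs × Unique vs × IsWalk vs ×
               Σ (Fin n) λ first → Σ (Fin n) λ lst →
               Σ (List (Fin n)) λ rest → vs ≡ first ∷ rest × Last vs lst × Adj lst first

  Acyclic : Set
  Acyclic = ∀ vs → ¬ IsCycle vs

  IsTree : Set
  IsTree = 1 ≤ n × Connected × Acyclic

  InducesStar : ℕ → (Fin n → Set) → Set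
  InducesStar m C =
    Σ (Fin n) λ c → Σ (Fin m → Fin n) λ leaf →
      Injective _≡_ _≡_ leaf ×
      (∀ i → ¬ leaf i ≡ c) ×
      (∀ x → (C x → (x ≡ c ⊎ ∃ λ i → x ≡ leaf i)) × ((x ≡ c ⊎ ∃ λ i → x ≡ leaf i) → C x)) ×
      (∀ x y → C x → C y →
         (Adj x y → (x ≡ c × ∃ λ i → y ≡ leaf i) ⊎ (y ≡ c × ∃ λ i → x ≡ leaf i)) ×
         ((x ≡ c × ∃ λ i → y ≡ leaf i) ⊎ (y ≡ c × ∃ λ i → x ≡ leaf i) → Adj x y))

  -- red-blue colouring: true = red, false = blue
  Colouring : Set
  Colouring = Fin n → Bool

  ColourComponent : Colouring → Fin n → (Fin n → Set)
  ColourComponent col v = λ u → WalkIn (λ x → col x ≡ col v) v u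

  -- every blue component is a single vertex (K_{1,0}) or a single edge (K_{1,1});
  -- every red component is a star with 1, 2 or 3 edges.
  GoodColouring : Colouring → Set
  GoodColouring col =
    (∀ v → col v ≡ false →
       InducesStar 0 (ColourComponent col v) ⊎ InducesStar 1 (ColourComponent col v)) ×
    (∀ v → col v ≡ true →
       InducesStar 1 (ColourComponent col v) ⊎ InducesStar 2 (ColourComponent col v)
         ⊎ InducesStar 3 (ColourComponent col v))

-- Root the tree at the end of a leaf-deletion order (only acyclicity is used) and
-- classify the vertices bottom-up into three kinds: a vertex is bare if all its
-- children are free, a fork if it has no fork child and at least two bare
-- children, and free otherwise.  Roles are then handed out from the root down:
-- a bare child of a blue vertex is blue and pairs up with it, its other children
-- become red centres; the non-free children of a red centre are its red leaves and
-- the free ones are blue; all children of a red leaf are blue.  Each blue component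
-- is then a vertex or an edge and each red component is a star around a red
-- centre, which has a red leaf because of its kind and at most three because of the
-- degree bound.  The degree bound is also what prevents a blue vertex from having
-- two blue children: such a vertex would be free with a fork child and a parent.

module Submission where

open import Defs
open import Data.Bool using (Bool; true; false; if_then_else_)
open import Data.Bool.Properties using () renaming (_≟_ to _≟ᵇ_)
open import Data.Empty using (⊥; ⊥-elim)
open import Data.Fin using (Fin; zero; suc; _≟_)
open import Data.Fin.Properties using (any?)
open import Data.List using (List; []; _∷_; _++_; [_]; length; lookup; filter; allFin; map)
open import Data.List.Properties using (length-++; filter-≐; length-tabulate; ++-assoc)
open import Data.List.Membership.Propositional using (_∈_)
open import Data.List.Membership.Propositional.Properties
  using (∈-∃++; ∈-++⁻; ∈-++⁺ˡ; ∈-++⁺ʳ; ∈-filter⁺; ∈-filter⁻; ∈-allFin; ∈-lookup)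
open import Data.List.Relation.Binary.Subset.Propositional using (_⊆_)
open import Data.List.Relation.Unary.All as All using (All; []; _∷_)
open import Data.List.Relation.Unary.All.Properties using (¬Any⇒All¬; ++⁻ˡ)
open import Data.List.Relation.Unary.Any using (here; there; index)
open import Data.List.Relation.Unary.Any.Properties using (lookup-index)
open import Data.List.Relation.Unary.AllPairs using ([]; _∷_)
open import Data.List.Relation.Unary.Unique.Propositional using (Unique)
open import Data.List.Relation.Unary.Unique.Propositional.Properties using (filter⁺; allFin⁺)
open import Data.Nat using (ℕ; zero; suc; _+_; _∸_; _≤_; _<_; z≤n; s≤s)
open import Data.Nat.GeneralisedArithmetic using (fold)
open import Data.Nat.ListAction using (sum)
open import Data.Nat.Properties hiding (_≟_)
open import Data.Product using (Σ; ∃; _×_; _,_; proj₁; proj₂)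
open import Relation.Nullary.Decidable using (_×-dec_)
open import Data.Sum using (_⊎_; inj₁; inj₂)
open import Function.Definitions using (Injective)
open import Relation.Binary.Definitions using (DecidableEquality; tri<; tri≈; tri>)
open import Relation.Binary.PropositionalEquality using (_≡_; _≢_; refl; sym; trans; cong; cong₂; subst; subst₂; module ≡-Reasoning)
open import Relation.Nullary using (¬_; ¬?; Dec; yes; no; contradiction)
open import Relation.Unary using (Pred; Decidable)
open import Data.Unit using (⊤; tt)
open import Level using (0ℓ)

-- Duplicate-free lists and counting

module _ {A : Set} where

  length-++-∷ : ∀ (xs : List A) {y} ys → length (xs ++ y ∷ ys) ≡ suc (length (xs ++ ys))
  length-++-∷ xs {y} ys = begin
    length (xs ++ y ∷ ys)      ≡⟨ length-++ xs ⟩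
    length xs + suc (length ys) ≡⟨ +-suc (length xs) (length ys) ⟩
    suc (length xs + length ys) ≡⟨ cong suc (sym (length-++ xs)) ⟩
    suc (length (xs ++ ys))     ∎
    where open ≡-Reasoning

  Unique-⊆⇒length≤ : ∀ {xs ys : List A} → Unique xs → xs ⊆ ys → length xs ≤ length ys
  Unique-⊆⇒length≤ {[]} _ _ = z≤n
  Unique-⊆⇒length≤ {x ∷ xs} {ys} (x∉xs ∷ xs!) xs⊆ys
    with as , bs , refl ← ∈-∃++ (xs⊆ys (here refl)) =
      subst (suc (length xs) ≤_) (sym (length-++-∷ as bs)) (s≤s (Unique-⊆⇒length≤ xs! xs⊆as++bs))
    where
    xs⊆as++bs : xs ⊆ as ++ bs
    xs⊆as++bs y∈xs with ∈-++⁻ as (xs⊆ys (there y∈xs))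
    ... | inj₁ y∈as         = ∈-++⁺ˡ y∈as
    ... | inj₂ (here refl)  = contradiction refl (All.lookup x∉xs y∈xs)
    ... | inj₂ (there y∈bs) = ∈-++⁺ʳ as y∈bs

  Unique-++⁻ˡ : ∀ xs {ys : List A} → Unique (xs ++ ys) → Unique xs
  Unique-++⁻ˡ []       _           = []
  Unique-++⁻ˡ (x ∷ xs) (x∉ ∷ xs!) = ++⁻ˡ xs x∉ ∷ Unique-++⁻ˡ xs xs!

  Unique⇒lookup-injective : ∀ {xs : List A} → Unique xs → Injective _≡_ _≡_ (lookup xs)
  Unique⇒lookup-injective {x ∷ xs} _           {zero}  {zero}  _ = refl
  Unique⇒lookup-injective {x ∷ xs} (x∉ ∷ _)   {zero}  {suc j} e = contradiction e (All.lookup x∉ (∈-lookup j))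
  Unique⇒lookup-injective {x ∷ xs} (x∉ ∷ _)   {suc i} {zero}  e = contradiction (sym e) (All.lookup x∉ (∈-lookup i))
  Unique⇒lookup-injective {x ∷ xs} (_ ∷ xs!) {suc i} {suc j} e = cong suc (Unique⇒lookup-injective xs! e)

  indicator-sum≡length-filter : (b : A → Bool) (xs : List A) →
    sum (map (λ x → if b x then 1 else 0) xs) ≡ length (filter (λ x → b x ≟ᵇ true) xs)
  indicator-sum≡length-filter b []       = refl
  indicator-sum≡length-filter b (x ∷ xs) with b x
  ... | true  = cong suc (indicator-sum≡length-filter b xs)
  ... | false = indicator-sum≡length-filter b xs

Unique⇒length≤n : ∀ {n} {xs : List (Fin n)} → Unique xs → length xs ≤ n
Unique⇒length≤n {xs = xs} xs! = subst (length xs ≤_) (length-tabulate (λ i → i)) (Unique-⊆⇒length≤ xs! (λ {x} _ → ∈-allFin x))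

module _ {n : ℕ} {P : Pred (Fin n) 0ℓ} (P? : Decidable P) where

  count : ℕ
  count = length (filter P? (allFin n))

  Unique⇒length≤count : ∀ {xs} → Unique xs → (∀ {x} → x ∈ xs → P x) → length xs ≤ count
  Unique⇒length≤count xs! xs⊆P =
    Unique-⊆⇒length≤ xs! (λ {x} x∈xs → ∈-filter⁺ P? (∈-allFin x) (xs⊆P x∈xs))

  count≡0⇒¬ : count ≡ 0 → ∀ {x} → ¬ P x
  count≡0⇒¬ count≡0 px = contradiction (subst (1 ≤_) count≡0 (Unique⇒length≤count ([] ∷ []) λ { (here refl) → px })) λ ()

  0<count⇒∃ : 0 < count → ∃ P
  0<count⇒∃ 0<count with filter P? (allFin n) in eq
  ... | x ∷ _ = x , proj₂ (∈-filter⁻ P? {xs = allFin n} (subst (x ∈_) (sym eq) (here refl)))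

  count≤1 : (∀ {x y} → P x → P y → x ≡ y) → count ≤ 1
  count≤1 P-unique = go (filter P? (allFin n)) (filter⁺ P? (allFin⁺ n)) (λ x∈ → proj₂ (∈-filter⁻ P? {xs = allFin n} x∈))
    where
    go : ∀ xs → Unique xs → (∀ {x} → x ∈ xs → P x) → length xs ≤ 1
    go []            _               _    = z≤n
    go (_ ∷ [])      _               _    = s≤s z≤n
    go (x ∷ y ∷ _) ((x≢y ∷ _) ∷ _) xs⊆P = contradiction (P-unique (xs⊆P (here refl)) (xs⊆P (there (here refl)))) x≢y

module _ {n : ℕ} {P Q : Pred (Fin n) 0ℓ} (P? : Decidable P) (Q? : Decidable Q) where

  count-cong : (∀ {x} → P x → Q x) → (∀ {x} → Q x → P x) → count P? ≡ count Q?
  count-cong P⇒Q Q⇒P = cong length (filter-≐ P? Q? (P⇒Q , Q⇒P) (allFin n))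

  count-< : (∀ {x} → P x → Q x) → ∀ {y} → ¬ P y → Q y → count P? < count Q?
  count-< P⇒Q {y} ¬py qy = Unique⇒length≤count Q? (y∉ ∷ filter⁺ P? (allFin⁺ n)) y∷P⊆Q
    where
    y∉ : All (λ x → ¬ y ≡ x) (filter P? (allFin n))
    y∉ = All.tabulate λ x∈ y≡x → ¬py (subst P (sym y≡x) (proj₂ (∈-filter⁻ P? {xs = allFin n} x∈)))
    y∷P⊆Q : ∀ {x} → x ∈ y ∷ filter P? (allFin n) → Q x
    y∷P⊆Q (here refl) = qy
    y∷P⊆Q (there x∈) = P⇒Q (proj₂ (∈-filter⁻ P? {xs = allFin n} x∈))

module _ {n : ℕ} (G : Graph n) where
  open Graph G

  Adj-sym : ∀ {u v} → Adj G u v → Adj G v u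
  Adj-sym {u} {v} uv = trans (symm v u) uv

  Adj-irrefl : ∀ {v} → ¬ Adj G v v
  Adj-irrefl {v} vv with () ← trans (sym (irrefl v)) vv

  Adj? : ∀ v → Decidable (Adj G v)
  Adj? v w = edge v w ≟ᵇ true

  Unique-nbrs⇒length≤degree : ∀ {v xs} → Unique xs → (∀ {x} → x ∈ xs → Adj G v x) → length xs ≤ degree G v
  Unique-nbrs⇒length≤degree {v} {xs} xs! xs⊆N =
    subst (length xs ≤_) (sym (indicator-sum≡length-filter (edge v) (allFin n))) (Unique⇒length≤count (Adj? v) xs! xs⊆N)

  IsWalk-++⁻ˡ : ∀ xs {ys} → IsWalk G (xs ++ ys) → IsWalk G xs
  IsWalk-++⁻ˡ []           _                  = nil
  IsWalk-++⁻ˡ (x ∷ [])     _                  = one x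
  IsWalk-++⁻ˡ (x ∷ y ∷ xs) (cons _ _ _ xy p) = cons x y xs xy (IsWalk-++⁻ˡ (y ∷ xs) p)

  Last-∷ʳ : ∀ xs w → Last G (xs ++ [ w ]) w
  Last-∷ʳ []       w = lastOne w
  Last-∷ʳ (x ∷ xs) w = lastCons x _ w (Last-∷ʳ xs w)

  WalkIn-start : ∀ {P u v} → WalkIn G P u v → P u
  WalkIn-start (here pu)     = pu
  WalkIn-start (step pu _ _) = pu

  WalkIn-end : ∀ {P u v} → WalkIn G P u v → P v
  WalkIn-end (here pv)    = pv
  WalkIn-end (step _ _ p) = WalkIn-end p

-- Star-shaped colour components

module StarComponents {n : ℕ} (G : Graph n) (col : Colouring G) where

  SameColourNbr : Fin n → Fin n → Set
  SameColourNbr c x = Adj G c x × col x ≡ col c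

  sameColourNbr? : ∀ c → Decidable (SameColourNbr c)
  sameColourNbr? c x = Adj? G c x ×-dec (col x ≟ᵇ col c)

  SameColourClosedNbr : Fin n → Fin n → Set
  SameColourClosedNbr c x = x ≡ c ⊎ SameColourNbr c x

  IsStarCentre : Fin n → Set
  IsStarCentre c = ∀ {x y} → SameColourNbr c x → SameColourNbr x y → y ≡ c

  closed-nbr-same-colour : ∀ {c x} → SameColourClosedNbr c x → col x ≡ col c
  closed-nbr-same-colour (inj₁ refl)        = refl
  closed-nbr-same-colour (inj₂ (_ , cx≡cc)) = cx≡cc

  module _ {v c : Fin n} (v∼c : SameColourClosedNbr c v) (centre : IsStarCentre c) where

    private
      Same : Fin n → Set
      Same x = col x ≡ col v

      leaves : List (Fin n)
      leaves = filter (sameColourNbr? c) (allFin n)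

      c-same : Same c
      c-same = sym (closed-nbr-same-colour v∼c)

      leaf-nbr : ∀ i → SameColourNbr c (lookup leaves i)
      leaf-nbr i = proj₂ (∈-filter⁻ (sameColourNbr? c) {xs = allFin n} (∈-lookup i))

      leaf-index : ∀ {x} → SameColourNbr c x → ∃ λ i → x ≡ lookup leaves i
      leaf-index cx = let x∈ = ∈-filter⁺ (sameColourNbr? c) (∈-allFin _) cx in index x∈ , lookup-index x∈

      stays-in-star : ∀ {a x} → SameColourClosedNbr c a → WalkIn G Same a x → SameColourClosedNbr c x
      stays-in-star a∼c           (here _)        = a∼c
      stays-in-star (inj₁ refl)   (step _ cw p)   = stays-in-star (inj₂ (cw , trans (WalkIn-start G p) (sym c-same))) p
      stays-in-star (inj₂ ca) (step a-same aw p) = stays-in-star (inj₁ (centre ca (aw , trans (WalkIn-start G p) (sym a-same)))) p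

      from-centre : ∀ {x} → SameColourClosedNbr c x → WalkIn G Same c x
      from-centre (inj₁ refl)          = here c-same
      from-centre (inj₂ (cx , cx≡cc)) = step c-same cx (here (trans cx≡cc c-same))

      reach-from : ∀ {u x} → SameColourClosedNbr c u → Same u → SameColourClosedNbr c x → WalkIn G Same u x
      reach-from (inj₁ refl)   _      x∼c = from-centre x∼c
      reach-from (inj₂ (cu , _)) u-same x∼c = step u-same (Adj-sym G cu) (from-centre x∼c)

      as-star : ∀ {x} → SameColourClosedNbr c x → x ≡ c ⊎ ∃ λ i → x ≡ lookup leaves i
      as-star (inj₁ x≡c) = inj₁ x≡c
      as-star (inj₂ cx)  = inj₂ (leaf-index cx)

      from-star : ∀ {x} → x ≡ c ⊎ (∃ λ i → x ≡ lookup leaves i) → SameColourClosedNbr c x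
      from-star (inj₁ x≡c)         = inj₁ x≡c
      from-star (inj₂ (i , refl)) = inj₂ (leaf-nbr i)

    component-induces-star : InducesStar G (count (sameColourNbr? c)) (ColourComponent G col v)
    component-induces-star =
      c , lookup leaves , Unique⇒lookup-injective (filter⁺ (sameColourNbr? c) (allFin⁺ n)) ,
      (λ i i≡c → Adj-irrefl G (subst (Adj G c) i≡c (proj₁ (leaf-nbr i)))) ,
      (λ x → (λ vx → as-star (stays-in-star v∼c vx)) , (λ x∈ → reach-from v∼c refl (from-star x∈))) ,
      λ x y vx vy → edges (stays-in-star v∼c vx) (stays-in-star v∼c vy) (trans (WalkIn-end G vy) (sym (WalkIn-end G vx))) , back
      where
      edges : ∀ {x y} → SameColourClosedNbr c x → SameColourClosedNbr c y → col y ≡ col x → Adj G x y →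
              (x ≡ c × ∃ λ i → y ≡ lookup leaves i) ⊎ (y ≡ c × ∃ λ i → x ≡ lookup leaves i)
      edges (inj₁ refl) (inj₁ refl) _   cc = contradiction cc (Adj-irrefl G)
      edges (inj₁ refl) (inj₂ cy)   _   _  = inj₁ (refl , leaf-index cy)
      edges (inj₂ cx)   _           y≡x xy = inj₂ (centre cx (xy , y≡x) , leaf-index cx)
      back : ∀ {x y} → (x ≡ c × ∃ λ i → y ≡ lookup leaves i) ⊎ (y ≡ c × ∃ λ i → x ≡ lookup leaves i) → Adj G x y
      back (inj₁ (refl , i , refl)) = proj₁ (leaf-nbr i)
      back (inj₂ (refl , i , refl)) = Adj-sym G (proj₁ (leaf-nbr i))

  sameColourNbrs≤degree : ∀ c → count (sameColourNbr? c) ≤ degree G c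
  sameColourNbrs≤degree c =
    Unique-nbrs⇒length≤degree G (filter⁺ (sameColourNbr? c) (allFin⁺ n))
      (λ x∈ → proj₁ (proj₂ (∈-filter⁻ (sameColourNbr? c) {xs = allFin n} x∈)))

  star-with-≤1-edge : ∀ {m C} → m ≤ 1 → InducesStar G m C → InducesStar G 0 C ⊎ InducesStar G 1 C
  star-with-≤1-edge {0}           _         s = inj₁ s
  star-with-≤1-edge {1}           _         s = inj₂ s
  star-with-≤1-edge {suc (suc _)} (s≤s ()) _

  star-with-1-to-3-edges : ∀ {m C} → 1 ≤ m → m ≤ 3 → InducesStar G m C →
                           InducesStar G 1 C ⊎ InducesStar G 2 C ⊎ InducesStar G 3 C
  star-with-1-to-3-edges {1} _ _ s = inj₁ s
  star-with-1-to-3-edges {2} _ _ s = inj₂ (inj₁ s)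
  star-with-1-to-3-edges {3} _ _ s = inj₂ (inj₂ s)
  star-with-1-to-3-edges {suc (suc (suc (suc _)))} _ (s≤s (s≤s (s≤s ()))) _

  good-colouring : MaxDegreeAtMost G 3 →
    (∀ v → col v ≡ false → ∃ λ c → SameColourClosedNbr c v × IsStarCentre c ×
                                    (∀ {x y} → SameColourNbr c x → SameColourNbr c y → x ≡ y)) →
    (∀ v → col v ≡ true → ∃ λ c → SameColourClosedNbr c v × IsStarCentre c × ∃ (SameColourNbr c)) →
    GoodColouring G col
  good-colouring Δ≤3 blue-centre red-centre = blue-components , red-components
    where
    blue-components : ∀ v → col v ≡ false → _
    blue-components v blue with c , v∼c , centre , nbr-unique ← blue-centre v blue =
      star-with-≤1-edge (count≤1 (sameColourNbr? c) nbr-unique) (component-induces-star v∼c centre)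
    red-components : ∀ v → col v ≡ true → _
    red-components v red with c , v∼c , centre , x , cx ← red-centre v red =
      star-with-1-to-3-edges (Unique⇒length≤count (sameColourNbr? c) ([] ∷ []) λ { (here refl) → cx })
        (≤-trans (sameColourNbrs≤degree c) (Δ≤3 c)) (component-induces-star v∼c centre)

-- Elimination orders of forests

module _ {n : ℕ} (G : Graph n) where

  AtMostOneNbrIn : Pred (Fin n) 0ℓ → Fin n → Set
  AtMostOneNbrIn S v = ∀ {x y} → S x → S y → Adj G v x → Adj G v y → x ≡ y

  record EliminationOrder (S : Pred (Fin n) 0ℓ) : Set where
    field
      rank                  : Fin n → ℕ
      bound                 : ℕ
      rank<bound            : ∀ v → rank v < bound
      adjacent-ranks-differ : ∀ {u v} → S u → S v → Adj G u v → rank u ≢ rank v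
      higher-nbr-unique     : ∀ {v} → S v → AtMostOneNbrIn (λ x → S x × rank v < rank x) v

  emptyOrder : ∀ {S} → ¬ ∃ S → EliminationOrder S
  emptyOrder ∄S = record
    { rank                  = λ _ → 0
    ; bound                 = 1
    ; rank<bound            = λ _ → s≤s z≤n
    ; adjacent-ranks-differ = λ su → contradiction (_ , su) ∄S
    ; higher-nbr-unique     = λ sv → contradiction (_ , sv) ∄S
    }

  addLeaf : ∀ {S ℓ} → S ℓ → AtMostOneNbrIn S ℓ → EliminationOrder (λ v → S v × v ≢ ℓ) → EliminationOrder S
  addLeaf {S} {ℓ} sℓ ℓ-leaf O = record
    { rank                  = rank
    ; bound                 = suc O.bound
    ; rank<bound            = rank<bound
    ; adjacent-ranks-differ = ranks-differ
    ; higher-nbr-unique     = higher-unique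
    }
    where
    module O = EliminationOrder O

    rank : Fin n → ℕ
    rank v with v ≟ ℓ
    ... | yes _ = 0
    ... | no _  = suc (O.rank v)

    rank-view : ∀ v → (v ≡ ℓ × rank v ≡ 0) ⊎ (v ≢ ℓ × rank v ≡ suc (O.rank v))
    rank-view v with v ≟ ℓ
    ... | yes v≡ℓ = inj₁ (v≡ℓ , refl)
    ... | no v≢ℓ  = inj₂ (v≢ℓ , refl)

    rank<bound : ∀ v → rank v < suc O.bound
    rank<bound v with rank-view v
    ... | inj₁ (_ , r≡0)   = subst (_< suc O.bound) (sym r≡0) (s≤s z≤n)
    ... | inj₂ (_ , r≡1+r) = subst (_< suc O.bound) (sym r≡1+r) (s≤s (O.rank<bound v))

    ranks-differ : ∀ {u v} → S u → S v → Adj G u v → rank u ≢ rank v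
    ranks-differ {u} {v} su sv uv with rank-view u | rank-view v
    ... | inj₁ (refl , _)    | inj₁ (refl , _)    = λ _ → Adj-irrefl G uv
    ... | inj₁ (_ , ru≡0)    | inj₂ (_ , rv≡1+r)  = λ ru≡rv → 0≢1+n (trans (sym ru≡0) (trans ru≡rv rv≡1+r))
    ... | inj₂ (_ , ru≡1+r)  | inj₁ (_ , rv≡0)    = λ ru≡rv → 0≢1+n (trans (sym rv≡0) (trans (sym ru≡rv) ru≡1+r))
    ... | inj₂ (u≢ℓ , ru≡1+r) | inj₂ (v≢ℓ , rv≡1+r) = λ ru≡rv →
      O.adjacent-ranks-differ (su , u≢ℓ) (sv , v≢ℓ) uv (suc-injective (trans (sym ru≡1+r) (trans ru≡rv rv≡1+r)))

    outranking⇒≢ℓ : ∀ {v x} → rank v < rank x → x ≢ ℓ × rank x ≡ suc (O.rank x)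
    outranking⇒≢ℓ {v} {x} v<x with rank-view x
    ... | inj₁ (_ , rx≡0) = contradiction (subst (rank v <_) rx≡0 v<x) λ ()
    ... | inj₂ x-old      = x-old

    higher-unique : ∀ {v} → S v → AtMostOneNbrIn (λ x → S x × rank v < rank x) v
    higher-unique {v} sv (sx , v<x) (sy , v<y) vx vy with rank-view v
    ... | inj₁ (refl , _) = ℓ-leaf sx sy vx vy
    ... | inj₂ (v≢ℓ , rv≡1+r)
      with x≢ℓ , rx≡1+r ← outranking⇒≢ℓ v<x | y≢ℓ , ry≡1+r ← outranking⇒≢ℓ v<y =
        O.higher-nbr-unique (sv , v≢ℓ) ((sx , x≢ℓ) , old-ranks v<x rx≡1+r) ((sy , y≢ℓ) , old-ranks v<y ry≡1+r) vx vy
      where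
      old-ranks : ∀ {x} → rank v < rank x → rank x ≡ suc (O.rank x) → O.rank v < O.rank x
      old-ranks {x} v<x rx≡1+r = ≤-pred (subst₂ _<_ rv≡1+r rx≡1+r v<x)

  module _ (acyclic : Acyclic G) where
    open import Data.List.Membership.DecPropositional (_≟_ {n}) using (_∈?_)

    nbr-on-path-is-next : ∀ {x y w} ys → Unique (x ∷ y ∷ ys) → IsWalk G (x ∷ y ∷ ys) → Adj G x w →
                          w ∈ y ∷ ys → w ≡ y
    nbr-on-path-is-next ys _ _ _ (here w≡y) = w≡y
    nbr-on-path-is-next {x} {y} {w} ys path! path xw (there w∈ys)
      with as , bs , refl ← ∈-∃++ w∈ys =
        contradiction (3≤length , Unique-++⁻ˡ cycle (subst Unique split path!) ,
                       IsWalk-++⁻ˡ G cycle (subst (IsWalk G) split path) ,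
                       x , w , _ , refl , Last-∷ʳ G (x ∷ y ∷ as) w , Adj-sym G xw)
                      (acyclic cycle)
      where
      cycle : List (Fin n)
      cycle = x ∷ y ∷ as ++ [ w ]
      split : x ∷ y ∷ as ++ w ∷ bs ≡ cycle ++ bs
      split = cong (λ l → x ∷ y ∷ l) (sym (++-assoc as [ w ] bs))
      3≤length : 3 ≤ length cycle
      3≤length = s≤s (s≤s (subst (1 ≤_) (sym (length-++ as)) (m≤n+m 1 (length as))))

    path-end-is-leaf : ∀ {S x} xs → Unique (x ∷ xs) → IsWalk G (x ∷ xs) →
                       (∀ {y} → S y → Adj G x y → y ∈ xs) → AtMostOneNbrIn S x
    path-end-is-leaf []       _     _    on-path sy _  xy _  = contradiction (on-path sy xy) λ ()
    path-end-is-leaf (z ∷ zs) path! path on-path sy sy′ xy xy′ =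
      trans (nbr-on-path-is-next zs path! path xy (on-path sy xy))
            (sym (nbr-on-path-is-next zs path! path xy′ (on-path sy′ xy′)))

    leaf-exists : ∀ {S} → Decidable S → ∃ S → ∃ λ ℓ → S ℓ × AtMostOneNbrIn S ℓ
    leaf-exists {S} S? (x , sx) = extend n [] (m≤m+n n 1) ([] ∷ []) (one x) sx
      where
      extend : ∀ k {x} xs → n ≤ k + length (x ∷ xs) → Unique (x ∷ xs) → IsWalk G (x ∷ xs) → S x →
               ∃ λ ℓ → S ℓ × AtMostOneNbrIn S ℓ
      extend k {x} xs fuel path! path sx with any? (λ w → S? w ×-dec (Adj? G x w ×-dec ¬? (w ∈? x ∷ xs)))
      ... | no stuck = x , sx , path-end-is-leaf xs path! path on-path
        where
        on-path : ∀ {y} → S y → Adj G x y → y ∈ xs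
        on-path {y} sy xy with y ∈? x ∷ xs
        ... | yes (here refl)  = contradiction xy (Adj-irrefl G)
        ... | yes (there y∈xs) = y∈xs
        ... | no y∉            = contradiction (y , sy , xy , y∉) stuck
      ... | yes (w , sw , xw , w∉) with k
      ...   | zero  = contradiction (≤-trans (Unique⇒length≤n longer!) fuel) (n≮n _)
        where longer! = ¬Any⇒All¬ _ w∉ ∷ path!
      ...   | suc k = extend k (x ∷ xs) (subst (n ≤_) (sym (+-suc k _)) fuel)
                        (¬Any⇒All¬ _ w∉ ∷ path!) (cons w x xs (Adj-sym G xw) path) sw

    eliminationOrder : ∀ k {S} (S? : Decidable S) → count S? ≤ k → EliminationOrder S
    eliminationOrder zero S? count≤0 =
      emptyOrder λ (x , sx) → contradiction (≤-trans (Unique⇒length≤count S? ([] ∷ []) λ { (here refl) → sx }) count≤0) λ ()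
    eliminationOrder (suc k) {S} S? count≤1+k with any? S?
    ... | no ∄S = emptyOrder ∄S
    ... | yes ∃S with ℓ , sℓ , ℓ-leaf ← leaf-exists S? ∃S =
      addLeaf sℓ ℓ-leaf (eliminationOrder k S∖ℓ? (≤-pred (≤-trans fewer count≤1+k)))
      where
      S∖ℓ? : Decidable (λ v → S v × v ≢ ℓ)
      S∖ℓ? v = S? v ×-dec ¬? (v ≟ ℓ)
      fewer : count S∖ℓ? < count S?
      fewer = count-< S∖ℓ? S? proj₁ (λ (_ , ℓ≢ℓ) → ℓ≢ℓ refl) sℓ

-- Recursion along a measure

module _ {n : ℕ} {A : Set} (measure : Fin n → ℕ) (F : (Fin n → A) → Fin n → A)
         (F-local : ∀ {f g} v → (∀ w → measure w < measure v → f w ≡ g w) → F f v ≡ F g v)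
         (f₀ : Fin n → A) where

  fold-stable : ∀ k v → measure v < k → fold f₀ F k v ≡ fold f₀ F (suc k) v
  fold-stable (suc k) v v<1+k = F-local v λ w w<v → fold-stable k w (<-≤-trans w<v (≤-pred v<1+k))

  fold-fixpoint : ∀ {N} → (∀ v → measure v < N) → ∀ v → fold f₀ F N v ≡ F (fold f₀ F N) v
  fold-fixpoint bounded v = fold-stable _ v (bounded v)

-- Kinds and roles

data Kind : Set where
  free fork bare : Kind

_≟ᴷ_ : DecidableEquality Kind
free ≟ᴷ free = yes refl
fork ≟ᴷ fork = yes refl
bare ≟ᴷ bare = yes refl
free ≟ᴷ fork = no λ ()
free ≟ᴷ bare = no λ ()
fork ≟ᴷ free = no λ ()
fork ≟ᴷ bare = no λ ()
bare ≟ᴷ free = no λ ()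
bare ≟ᴷ fork = no λ ()

kindOf : (forkChildren bareChildren : ℕ) → Kind
kindOf (suc _) _             = free
kindOf zero    zero          = bare
kindOf zero    (suc zero)    = free
kindOf zero    (suc (suc _)) = fork

kindOf-bare⁻ : ∀ f b → kindOf f b ≡ bare → f ≡ 0 × b ≡ 0
kindOf-bare⁻ zero zero _ = refl , refl
kindOf-bare⁻ zero (suc zero) ()
kindOf-bare⁻ zero (suc (suc _)) ()

kindOf-fork⁻ : ∀ f b → kindOf f b ≡ fork → f ≡ 0 × 1 ≤ b
kindOf-fork⁻ zero (suc (suc _)) _ = refl , s≤s z≤n

kindOf-free⁻ : ∀ f b → kindOf f b ≡ free → 1 ≤ f ⊎ b ≡ 1
kindOf-free⁻ (suc _) _          _ = inj₁ (s≤s z≤n)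
kindOf-free⁻ zero    (suc zero) _ = inj₂ refl

data Role : Set where
  blue redCentre redLeaf : Role

isRed : Role → Bool
isRed blue      = false
isRed redCentre = true
isRed redLeaf   = true

isRed-false⁻ : ∀ r → isRed r ≡ false → r ≡ blue
isRed-false⁻ blue _ = refl

isBlue? : ∀ r → Dec (r ≡ blue)
isBlue? blue      = yes refl
isBlue? redCentre = no λ ()
isBlue? redLeaf   = no λ ()

rootRole : Kind → Role
rootRole free = redCentre
rootRole fork = redCentre
rootRole bare = blue

childRole : (parentRole : Role) → Kind → Role
childRole blue      free = redCentre
childRole blue      fork = redCentre
childRole blue      bare = blue
childRole redCentre free = blue
childRole redCentre fork = redLeaf
childRole redCentre bare = redLeaf
childRole redLeaf   _    = blue

rootRole≢redLeaf : ∀ k → rootRole k ≢ redLeaf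
rootRole≢redLeaf free ()
rootRole≢redLeaf fork ()
rootRole≢redLeaf bare ()

rootRole-redCentre⁻ : ∀ k → rootRole k ≡ redCentre → k ≢ bare
rootRole-redCentre⁻ bare () refl

childRole-redCentre⁻ : ∀ r k → childRole r k ≡ redCentre → r ≡ blue × k ≢ bare
childRole-redCentre⁻ blue free _ = refl , λ ()
childRole-redCentre⁻ blue fork _ = refl , λ ()
childRole-redCentre⁻ blue      bare ()
childRole-redCentre⁻ redCentre bare ()
childRole-redCentre⁻ redLeaf   bare ()

childRole-redLeaf⁻ : ∀ r k → childRole r k ≡ redLeaf → r ≡ redCentre × k ≢ free
childRole-redLeaf⁻ redCentre fork _ = refl , λ ()
childRole-redLeaf⁻ redCentre bare _ = refl , λ ()
childRole-redLeaf⁻ blue      free ()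
childRole-redLeaf⁻ redCentre free ()
childRole-redLeaf⁻ redLeaf   free ()

childRole-redCentre-non-free : ∀ k → k ≢ free → childRole redCentre k ≡ redLeaf
childRole-redCentre-non-free free free≢free = contradiction refl free≢free
childRole-redCentre-non-free fork _         = refl
childRole-redCentre-non-free bare _         = refl

childRole-redCentre-red : ∀ k → childRole redCentre k ≢ blue → childRole redCentre k ≡ redLeaf
childRole-redCentre-red free blue≢blue = contradiction refl blue≢blue
childRole-redCentre-red fork _         = refl
childRole-redCentre-red bare _         = refl

childRole-blue⁻ : ∀ r k → childRole r k ≡ blue → (r ≡ blue × k ≡ bare) ⊎ (r ≡ redCentre × k ≡ free) ⊎ r ≡ redLeaf
childRole-blue⁻ blue      bare _ = inj₁ (refl , refl)
childRole-blue⁻ redCentre free _ = inj₂ (inj₁ (refl , refl))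
childRole-blue⁻ redLeaf   _    _ = inj₂ (inj₂ refl)

module RootedColouring {n : ℕ} (G : Graph n) (order : EliminationOrder G (λ _ → ⊤)) where
  open EliminationOrder order

  Parent : Fin n → Fin n → Set
  Parent v p = Adj G v p × rank v < rank p

  Parent? : ∀ v → Decidable (Parent v)
  Parent? v p = Adj? G v p ×-dec (rank v <? rank p)

  parent-unique : ∀ {v p q} → Parent v p → Parent v q → p ≡ q
  parent-unique (vp , v<p) (vq , v<q) = higher-nbr-unique tt (tt , v<p) (tt , v<q) vp vq

  adjacent⇒parent : ∀ {u v} → Adj G u v → Parent u v ⊎ Parent v u
  adjacent⇒parent {u} {v} uv with <-cmp (rank u) (rank v)
  ... | tri< u<v _ _ = inj₁ (uv , u<v)
  ... | tri≈ _ u≡v _ = contradiction u≡v (adjacent-ranks-differ tt tt uv)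
  ... | tri> _ _ v<u = inj₂ (Adj-sym G uv , v<u)

  child≢parent : ∀ {w v p} → Parent w v → Parent v p → w ≢ p
  child≢parent (_ , w<v) (_ , v<p) refl = <-asym w<v v<p

  childOfKind? : (κ : Fin n → Kind) (k : Kind) (v : Fin n) → Decidable (λ w → Parent w v × κ w ≡ k)
  childOfKind? κ k v w = Parent? w v ×-dec (κ w ≟ᴷ k)

  #children : (Fin n → Kind) → Kind → Fin n → ℕ
  #children κ k v = count (childOfKind? κ k v)

  kindStep : (Fin n → Kind) → Fin n → Kind
  kindStep κ v = kindOf (#children κ fork v) (#children κ bare v)

  kindStep-local : ∀ {κ κ′} v → (∀ w → rank w < rank v → κ w ≡ κ′ w) → kindStep κ v ≡ kindStep κ′ v
  kindStep-local {κ} {κ′} v agree = cong₂ kindOf (same-count fork) (same-count bare)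
    where
    same-count : ∀ k → #children κ k v ≡ #children κ′ k v
    same-count k = count-cong (childOfKind? κ k v) (childOfKind? κ′ k v)
                              (λ (wv , κw≡k) → wv , trans (sym (agree _ (proj₂ wv))) κw≡k)
                              (λ (wv , κ′w≡k) → wv , trans (agree _ (proj₂ wv)) κ′w≡k)

  kind : Fin n → Kind
  kind = fold (λ _ → bare) kindStep bound

  kind-eq : ∀ v → kind v ≡ kindOf (#children kind fork v) (#children kind bare v)
  kind-eq = fold-fixpoint rank kindStep kindStep-local _ rank<bound

  roleStep : (Fin n → Role) → Fin n → Role
  roleStep ρ v with any? (Parent? v)
  ... | yes (p , _) = childRole (ρ p) (kind v)
  ... | no _        = rootRole (kind v)

  depth : Fin n → ℕ
  depth v = bound ∸ rank v

  roleStep-local : ∀ {ρ ρ′} v → (∀ w → depth w < depth v → ρ w ≡ ρ′ w) → roleStep ρ v ≡ roleStep ρ′ v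
  roleStep-local v agree with any? (Parent? v)
  ... | yes (p , _ , v<p) = cong (λ r → childRole r (kind v)) (agree p (∸-monoʳ-< v<p (<⇒≤ (rank<bound p))))
  ... | no _              = refl

  role : Fin n → Role
  role = fold (λ _ → blue) roleStep (suc bound)

  role-cases : ∀ v → (¬ ∃ (Parent v) × role v ≡ rootRole (kind v)) ⊎
                     (∃ λ p → Parent v p × role v ≡ childRole (role p) (kind v))
  role-cases v = cases (fold-fixpoint depth roleStep roleStep-local _ (λ w → s≤s (m∸n≤m bound (rank w))) v)
    where
    cases : ∀ {r} → r ≡ roleStep role v → (¬ ∃ (Parent v) × r ≡ rootRole (kind v)) ⊎
                                          (∃ λ p → Parent v p × r ≡ childRole (role p) (kind v))
    cases r≡ with any? (Parent? v)
    ... | yes (p , vp) = inj₂ (p , vp , r≡)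
    ... | no ∄p        = inj₁ (∄p , r≡)

  role-child : ∀ {v p} → Parent v p → role v ≡ childRole (role p) (kind v)
  role-child {v} vp with role-cases v
  ... | inj₁ (∄p , _)      = contradiction (_ , vp) ∄p
  ... | inj₂ (q , vq , r≡) = trans r≡ (cong (λ q → childRole (role q) (kind v)) (parent-unique vq vp))

  colour : Colouring G
  colour v = isRed (role v)

  bare⇒children-free : ∀ {v w} → kind v ≡ bare → Parent w v → kind w ≡ free
  bare⇒children-free {v} {w} kv wv with kindOf-bare⁻ _ _ (trans (sym (kind-eq v)) kv) | kind w in kw
  ... | _        , _        | free = refl
  ... | no-forks , _        | fork = contradiction (wv , kw) (count≡0⇒¬ (childOfKind? kind fork v) no-forks)
  ... | _        , no-bares | bare = contradiction (wv , kw) (count≡0⇒¬ (childOfKind? kind bare v) no-bares)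

  non-free⇒no-fork-child : ∀ {v w} → kind v ≢ free → Parent w v → kind w ≢ fork
  non-free⇒no-fork-child {v} kv≢free wv kw with kind v in kv
  ... | free = kv≢free refl
  ... | fork = count≡0⇒¬ (childOfKind? kind fork v) (proj₁ (kindOf-fork⁻ _ _ (trans (sym (kind-eq v)) kv))) (wv , kw)
  ... | bare = contradiction (trans (sym kw) (bare⇒children-free kv wv)) λ ()

  non-free-child-of-kind : ∀ {v k} → 0 < #children kind k v → k ≢ free → ∃ λ w → Parent w v × kind w ≢ free
  non-free-child-of-kind {v} {k} 0<# k≢free with w , wv , kw ← 0<count⇒∃ (childOfKind? kind k v) 0<# =
    w , wv , λ kw≡free → k≢free (trans (sym kw) kw≡free)

  non-bare⇒non-free-child : ∀ {v} → kind v ≢ bare → ∃ λ w → Parent w v × kind w ≢ free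
  non-bare⇒non-free-child {v} kv≢bare with kind v in kv
  ... | bare = contradiction refl kv≢bare
  ... | fork = non-free-child-of-kind (proj₂ (kindOf-fork⁻ _ _ (trans (sym (kind-eq v)) kv))) λ ()
  ... | free with kindOf-free⁻ _ _ (trans (sym (kind-eq v)) kv)
  ...   | inj₁ 0<forks  = non-free-child-of-kind 0<forks λ ()
  ...   | inj₂ one-bare = non-free-child-of-kind (subst (0 <_) (sym one-bare) (s≤s z≤n)) λ ()

  free⇒fork-child : ∀ {v x y} → kind v ≡ free → Parent x v → Parent y v → kind x ≡ bare → kind y ≡ bare → x ≢ y →
                    ∃ λ w → Parent w v × kind w ≡ fork
  free⇒fork-child {v} kv xv yv kx ky x≢y with kindOf-free⁻ _ _ (trans (sym (kind-eq v)) kv)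
  ... | inj₁ 0<forks  = 0<count⇒∃ (childOfKind? kind fork v) 0<forks
  ... | inj₂ one-bare = contradiction (subst (2 ≤_) one-bare two-bare) λ { (s≤s ()) }
    where
    two-bare : 2 ≤ #children kind bare v
    two-bare = Unique⇒length≤count (childOfKind? kind bare v) ((x≢y ∷ []) ∷ [] ∷ [])
                 λ { (here refl) → xv , kx ; (there (here refl)) → yv , ky }

  redCentre⁻ : ∀ {v} → role v ≡ redCentre → (∀ {p} → Parent v p → role p ≡ blue) × kind v ≢ bare
  redCentre⁻ {v} rv with role-cases v
  ... | inj₁ (∄p , r≡) = (λ vp → contradiction (_ , vp) ∄p) , rootRole-redCentre⁻ _ (trans (sym r≡) rv)
  ... | inj₂ (p , vp , r≡) with rp , kv ← childRole-redCentre⁻ _ _ (trans (sym r≡) rv) =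
    (λ vq → subst (λ q → role q ≡ blue) (parent-unique vp vq) rp) , kv

  redLeaf⁻ : ∀ {v} → role v ≡ redLeaf → ∃ λ p → Parent v p × role p ≡ redCentre × kind v ≢ free
  redLeaf⁻ {v} rv with role-cases v
  ... | inj₁ (_ , r≡)      = contradiction (trans (sym r≡) rv) (rootRole≢redLeaf (kind v))
  ... | inj₂ (p , vp , r≡) = p , vp , childRole-redLeaf⁻ _ _ (trans (sym r≡) rv)

  blue-child-of-blue⇒bare : ∀ {v p} → Parent v p → role v ≡ blue → role p ≡ blue → kind v ≡ bare
  blue-child-of-blue⇒bare vp rv rp with childRole-blue⁻ _ _ (trans (sym (role-child vp)) rv)
  ... | inj₁ (_ , kv)              = kv
  ... | inj₂ (inj₁ (rp′ , _)) = contradiction (trans (sym rp) rp′) λ ()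
  ... | inj₂ (inj₂ rp′)       = contradiction (trans (sym rp) rp′) λ ()

  blue-fork⇒redLeaf-parent : ∀ {v} → role v ≡ blue → kind v ≡ fork → ∃ λ p → Parent v p × role p ≡ redLeaf
  blue-fork⇒redLeaf-parent {v} rv kv with role-cases v
  ... | inj₁ (_ , r≡) = contradiction (trans (sym rv) (trans r≡ (cong rootRole kv))) λ ()
  ... | inj₂ (p , vp , r≡) with childRole-blue⁻ _ _ (trans (sym r≡) rv)
  ...   | inj₁ (_ , kv′)        = contradiction (trans (sym kv) kv′) λ ()
  ...   | inj₂ (inj₁ (_ , kv′)) = contradiction (trans (sym kv) kv′) λ ()
  ...   | inj₂ (inj₂ rp)         = p , vp , rp

  blue-free⇒parent : ∀ {v} → role v ≡ blue → kind v ≡ free → ∃ (Parent v)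
  blue-free⇒parent {v} rv kv with role-cases v
  ... | inj₁ (_ , r≡)     = contradiction (trans (sym rv) (trans r≡ (cong rootRole kv))) λ ()
  ... | inj₂ (p , vp , _) = p , vp

  open StarComponents G colour

  same-colour-as-blue : ∀ {c x} → role c ≡ blue → colour x ≡ colour c → role x ≡ blue
  same-colour-as-blue rc same = isRed-false⁻ _ (trans same (cong isRed rc))

  same-colour-as-redCentre : ∀ {c x} → role c ≡ redCentre → colour x ≡ colour c → role x ≢ blue
  same-colour-as-redCentre rc same rx = contradiction (trans (sym rc) (same-colour-as-blue rx (sym same))) λ ()

  BlueCentre : Fin n → Set
  BlueCentre c = role c ≡ blue × (∀ {p} → Parent c p → role p ≢ blue)

  blue-nbr⁻ : ∀ {c x} → BlueCentre c → SameColourNbr c x → Parent x c × kind x ≡ bare × role x ≡ blue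
  blue-nbr⁻ (rc , no-blue-parent) (cx , same) with adjacent⇒parent cx
  ... | inj₁ cx′ = contradiction (same-colour-as-blue rc same) (no-blue-parent cx′)
  ... | inj₂ xc  = xc , blue-child-of-blue⇒bare xc (same-colour-as-blue rc same) rc , same-colour-as-blue rc same

  blueCentre-is-star : ∀ {c} → BlueCentre c → IsStarCentre c
  blueCentre-is-star bc cx (xy , same) with xc , kx , rx ← blue-nbr⁻ bc cx | adjacent⇒parent xy
  ... | inj₁ xy′ = parent-unique xy′ xc
  ... | inj₂ yx  = contradiction (trans (sym (same-colour-as-blue rx same))
                                        (trans (role-child yx) (cong₂ childRole rx (bare⇒children-free kx yx)))) λ ()

  blueCentre-nbr-unique : MaxDegreeAtMost G 3 → ∀ {c} → BlueCentre c →
                          ∀ {x y} → SameColourNbr c x → SameColourNbr c y → x ≡ y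
  blueCentre-nbr-unique Δ≤3 {c} bc {x} {y} cx cy with x ≟ y
  ... | yes x≡y = x≡y
  ... | no x≢y  = ⊥-elim (by-kind (kind c) refl)
    where
    x-bare-child = blue-nbr⁻ bc cx
    y-bare-child = blue-nbr⁻ bc cy
    by-kind : ∀ k → kind c ≡ k → ⊥
    by-kind bare kc = contradiction (trans (sym (proj₁ (proj₂ x-bare-child))) (bare⇒children-free kc (proj₁ x-bare-child))) λ ()
    by-kind fork kc with p , cp , rp ← blue-fork⇒redLeaf-parent (proj₁ bc) kc = non-free⇒no-fork-child (proj₂ (proj₂ (proj₂ (redLeaf⁻ rp)))) cp kc
    by-kind free kc
      with p , cp ← blue-free⇒parent (proj₁ bc) kc
         | xc , kx , _ ← x-bare-child | yc , ky , _ ← y-bare-child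
      with w , wc , kw ← free⇒fork-child kc xc yc kx ky x≢y =
        n≮n 3 (≤-trans (Unique-nbrs⇒length≤degree G four-distinct four-nbrs) (Δ≤3 c))
      where
      kinds-differ : ∀ {a b} → kind a ≡ fork → kind b ≡ bare → a ≢ b
      kinds-differ ka kb refl = contradiction (trans (sym ka) kb) λ ()
      four-distinct : Unique (w ∷ x ∷ y ∷ p ∷ [])
      four-distinct = (kinds-differ kw kx ∷ kinds-differ kw ky ∷ child≢parent wc cp ∷ []) ∷
                      (x≢y ∷ child≢parent xc cp ∷ []) ∷ (child≢parent yc cp ∷ []) ∷ [] ∷ []
      four-nbrs : ∀ {a} → a ∈ w ∷ x ∷ y ∷ p ∷ [] → Adj G c a
      four-nbrs (here refl)                         = Adj-sym G (proj₁ wc)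
      four-nbrs (there (here refl))                 = proj₁ cx
      four-nbrs (there (there (here refl)))         = proj₁ cy
      four-nbrs (there (there (there (here refl)))) = proj₁ cp

  blue-centre : ∀ {v} → role v ≡ blue → ∃ λ c → SameColourClosedNbr c v × BlueCentre c
  blue-centre {v} rv with role-cases v
  ... | inj₁ (∄p , _)     = v , inj₁ refl , rv , λ vp → contradiction (_ , vp) ∄p
  ... | inj₂ (p , vp , _) with isBlue? (role p)
  ...   | no rp≢blue = v , inj₁ refl , rv , λ vq → subst (λ q → role q ≢ blue) (parent-unique vp vq) rp≢blue
  ...   | yes rp     = p , inj₂ (Adj-sym G (proj₁ vp) , cong isRed (trans rv (sym rp))) , rp , grandparent-not-blue
    where
    grandparent-not-blue : ∀ {q} → Parent p q → role q ≢ blue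
    grandparent-not-blue pq rq =
      contradiction (trans (sym (blue-child-of-blue⇒bare vp rv rp)) (bare⇒children-free (blue-child-of-blue⇒bare pq rp rq) vp)) λ ()

  red-nbr⁻ : ∀ {c x} → role c ≡ redCentre → SameColourNbr c x → Parent x c × role x ≡ redLeaf
  red-nbr⁻ {c} {x} rc (cx , same) with adjacent⇒parent cx
  ... | inj₁ cx′ = contradiction (proj₁ (redCentre⁻ rc) cx′) (same-colour-as-redCentre rc same)
  ... | inj₂ xc  = xc , trans rx (childRole-redCentre-red _ λ r≡blue → same-colour-as-redCentre rc same (trans rx r≡blue))
    where
    rx : role x ≡ childRole redCentre (kind x)
    rx = trans (role-child xc) (cong (λ r → childRole r (kind x)) rc)

  redCentre-is-star : ∀ {c} → role c ≡ redCentre → IsStarCentre c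
  redCentre-is-star rc cx (xy , same) with xc , rx ← red-nbr⁻ rc cx | adjacent⇒parent xy
  ... | inj₁ xy′ = parent-unique xy′ xc
  ... | inj₂ yx  = contradiction (trans (role-child yx) (cong (λ r → childRole r (kind _)) rx))
                                 λ ry → same-colour-as-redCentre rc (trans same (proj₂ cx)) ry

  redCentre-has-nbr : ∀ {c} → role c ≡ redCentre → ∃ (SameColourNbr c)
  redCentre-has-nbr {c} rc with w , wc , kw ← non-bare⇒non-free-child (proj₂ (redCentre⁻ rc)) =
    w , Adj-sym G (proj₁ wc) , trans (cong isRed rw) (sym (cong isRed rc))
    where
    rw : role w ≡ redLeaf
    rw = trans (role-child wc) (trans (cong (λ r → childRole r (kind w)) rc) (childRole-redCentre-non-free _ kw))

  red-centre : ∀ {v} → colour v ≡ true → ∃ λ c → SameColourClosedNbr c v × role c ≡ redCentre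
  red-centre {v} red = by-role (role v) refl
    where
    by-role : ∀ r → role v ≡ r → ∃ λ c → SameColourClosedNbr c v × role c ≡ redCentre
    by-role blue      rv = contradiction (trans (sym red) (cong isRed rv)) λ ()
    by-role redCentre rv = v , inj₁ refl , rv
    by-role redLeaf   rv with p , vp , rp , _ ← redLeaf⁻ rv =
      p , inj₂ (Adj-sym G (proj₁ vp) , trans (cong isRed rv) (sym (cong isRed rp))) , rp

  colour-good : MaxDegreeAtMost G 3 → GoodColouring G colour
  colour-good Δ≤3 = good-colouring Δ≤3
    (λ v blue → let c , v∼c , bc = blue-centre (isRed-false⁻ _ blue) in
                c , v∼c , blueCentre-is-star bc , blueCentre-nbr-unique Δ≤3 bc)
    (λ v red → let c , v∼c , rc = red-centre red in
               c , v∼c , redCentre-is-star rc , redCentre-has-nbr rc)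

mainTheorem3 : (n : ℕ) (T : Graph n) → IsTree T → MaxDegreeAtMost T 3 →
    Σ (Colouring T) λ col → GoodColouring T col
mainTheorem3 n T (_ , _ , acyclic) Δ≤3 = colour , colour-good Δ≤3
  where open RootedColouring T (eliminationOrder T acyclic _ (λ _ → yes tt) ≤-refl)
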